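{- Let $(j:A\to C,k:B\to C)$ be the cocomma cospan of some span $(p':W'\to A,q':W'\to B)$ in $\mathsf{Pos}$, and let $(p:W\to A,q:W\to B)$ be a span in $\mathsf{Pos}$ such that the square formed by $p,q,j,k$ is exact. Then $(j,k)$ is the cocomma of the span $(p,q)$.
   Context: $\mathsf{Pos}$ is the category of posets and monotone maps. The cocomma of a span $A\xleftarrow{p}W\xrightarrow{q}B$ is a cospan $A\xrightarrow{j}C\xleftarrow{k}B$ with $jp\le kq$ (pointwise) such that every cospan $(j'',k'')$ with $j''p\le k''q$ factors uniquely through $(j,k)$ (a unique $h$ with $hj=j''$, $hk=k''$), the factorisation being monotone in the cospan. A square $p,q,j,k$ is exact if $jp\le kq$ and for all $a\in A,b\in B$ with $j(a)\le k(b)$ there is $w\in W$ with $a\le p(w)$ and $q(w)\le b$. -}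

module Defs where

open import Level using (Level; _⊔_; suc)
open import Data.Product using (Σ; Σ-syntax; ∃-syntax; _×_)
open import Relation.Binary.Bundles using (Poset)
open import Relation.Binary.Morphism.Bundles using (PosetHomomorphism)

Mono : ∀ {c ℓ₁ ℓ₂} → Poset c ℓ₁ ℓ₂ → Poset c ℓ₁ ℓ₂ → Set (c ⊔ ℓ₁ ⊔ ℓ₂)
Mono P Q = PosetHomomorphism P Q

⟪_⟫ : ∀ {c ℓ₁ ℓ₂} {P Q : Poset c ℓ₁ ℓ₂} → Mono P Q → Poset.Carrier P → Poset.Carrier Q
⟪ f ⟫ = PosetHomomorphism.⟦_⟧ f

_∘_≤_∘_ : ∀ {c ℓ₁ ℓ₂} {W X Y Z : Poset c ℓ₁ ℓ₂} →
          Mono X Z → Mono W X → Mono Y Z → Mono W Y → Set (c ⊔ ℓ₂)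
_∘_≤_∘_ {W = W} {Z = Z} f g f' g' =
  ∀ (w : Poset.Carrier W) → Poset._≤_ Z (⟪ f ⟫ (⟪ g ⟫ w)) (⟪ f' ⟫ (⟪ g' ⟫ w))

_≤ₘ_ : ∀ {c ℓ₁ ℓ₂} {X Z : Poset c ℓ₁ ℓ₂} → Mono X Z → Mono X Z → Set (c ⊔ ℓ₂)
_≤ₘ_ {X = X} {Z = Z} f g = ∀ (x : Poset.Carrier X) → Poset._≤_ Z (⟪ f ⟫ x) (⟪ g ⟫ x)

_≈ₘ_ : ∀ {c ℓ₁ ℓ₂} {X Z : Poset c ℓ₁ ℓ₂} → Mono X Z → Mono X Z → Set (c ⊔ ℓ₁)
_≈ₘ_ {X = X} {Z = Z} f g = ∀ (x : Poset.Carrier X) → Poset._≈_ Z (⟪ f ⟫ x) (⟪ g ⟫ x)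

_factors_via_ : ∀ {c ℓ₁ ℓ₂} {X C D : Poset c ℓ₁ ℓ₂} → Mono C D → Mono X D → Mono X C → Set (c ⊔ ℓ₁)
_factors_via_ {X = X} {D = D} h j'' j = ∀ (x : Poset.Carrier X) → Poset._≈_ D (⟪ h ⟫ (⟪ j ⟫ x)) (⟪ j'' ⟫ x)

record IsCocomma {c ℓ₁ ℓ₂} {W A B C : Poset c ℓ₁ ℓ₂}
                 (p : Mono W A) (q : Mono W B) (j : Mono A C) (k : Mono B C)
                 : Set (suc (c ⊔ ℓ₁ ⊔ ℓ₂)) where
  field
    lax : j ∘ p ≤ k ∘ q
    factor : ∀ (D : Poset c ℓ₁ ℓ₂) (j'' : Mono A D) (k'' : Mono B D) →
             j'' ∘ p ≤ k'' ∘ q →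
             Σ[ h ∈ Mono C D ] (h factors j'' via j × h factors k'' via k)
    unique : ∀ (D : Poset c ℓ₁ ℓ₂) (j'' : Mono A D) (k'' : Mono B D) →
             j'' ∘ p ≤ k'' ∘ q →
             (h h' : Mono C D) →
             h factors j'' via j → h factors k'' via k →
             h' factors j'' via j → h' factors k'' via k →
             h ≈ₘ h'
    monotone : ∀ (D : Poset c ℓ₁ ℓ₂) (j₁ j₂ : Mono A D) (k₁ k₂ : Mono B D) →
               j₁ ∘ p ≤ k₁ ∘ q → j₂ ∘ p ≤ k₂ ∘ q →
               j₁ ≤ₘ j₂ → k₁ ≤ₘ k₂ →
               (h₁ h₂ : Mono C D) →
               h₁ factors j₁ via j → h₁ factors k₁ via k →
               h₂ factors j₂ via j → h₂ factors k₂ via k →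
               h₁ ≤ₘ h₂

record IsExact {c ℓ₁ ℓ₂} {W A B C : Poset c ℓ₁ ℓ₂}
               (p : Mono W A) (q : Mono W B) (j : Mono A C) (k : Mono B C)
               : Set (c ⊔ ℓ₂) where
  field
    lax : j ∘ p ≤ k ∘ q
    exact : ∀ (a : Poset.Carrier A) (b : Poset.Carrier B) →
            Poset._≤_ C (⟪ j ⟫ a) (⟪ k ⟫ b) →
            ∃[ w ] (Poset._≤_ A a (⟪ p ⟫ w) × Poset._≤_ B (⟪ q ⟫ w) b)

module Submission where

open import Defs
open import Data.Product using (_,_)
open import Relation.Binary.Bundles using (Poset)
open import Relation.Binary.Morphism.Bundles using (PosetHomomorphism)

-- Apply exactness to the instance j (p' w') ≤ k (q' w') and route through the witness w.
exact⇒lax-transfer : ∀ {c ℓ₁ ℓ₂} {W' W A B C : Poset c ℓ₁ ℓ₂}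
                       {p' : Mono W' A} {q' : Mono W' B} {p : Mono W A} {q : Mono W B}
                       {j : Mono A C} {k : Mono B C} →
                       j ∘ p' ≤ k ∘ q' → IsExact p q j k →
                       (D : Poset c ℓ₁ ℓ₂) (j'' : Mono A D) (k'' : Mono B D) →
                       j'' ∘ p ≤ k'' ∘ q → j'' ∘ p' ≤ k'' ∘ q'
exact⇒lax-transfer {p' = p'} {q' = q'} lax' ex D j'' k'' lax w'
  with IsExact.exact ex (⟪ p' ⟫ w') (⟪ q' ⟫ w') (lax' w')
... | w , p'w'≤pw , qw≤q'w' =
  Poset.trans D (PosetHomomorphism.mono j'' p'w'≤pw)
    (Poset.trans D (lax w) (PosetHomomorphism.mono k'' qw≤q'w'))

-- The universal property mentions the span only through which cospans are lax over it.
IsCocomma-restrict : ∀ {c ℓ₁ ℓ₂} {W' W A B C : Poset c ℓ₁ ℓ₂}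
                       {p' : Mono W' A} {q' : Mono W' B} {p : Mono W A} {q : Mono W B}
                       {j : Mono A C} {k : Mono B C} →
                       IsCocomma p' q' j k → j ∘ p ≤ k ∘ q →
                       (∀ (D : Poset c ℓ₁ ℓ₂) (j'' : Mono A D) (k'' : Mono B D) →
                          j'' ∘ p ≤ k'' ∘ q → j'' ∘ p' ≤ k'' ∘ q') →
                       IsCocomma p q j k
IsCocomma-restrict cc lax transfer = record
  { lax = lax
  ; factor = λ D j'' k'' l → IsCocomma.factor cc D j'' k'' (transfer D j'' k'' l)
  ; unique = λ D j'' k'' l → IsCocomma.unique cc D j'' k'' (transfer D j'' k'' l)
  ; monotone = λ D j₁ j₂ k₁ k₂ l₁ l₂ →
      IsCocomma.monotone cc D j₁ j₂ k₁ k₂ (transfer D j₁ k₁ l₁) (transfer D j₂ k₂ l₂)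
  }

proposition3p11 : ∀ {c ℓ₁ ℓ₂} {W' W A B C : Poset c ℓ₁ ℓ₂}
                    (p' : Mono W' A) (q' : Mono W' B) (j : Mono A C) (k : Mono B C) →
                    IsCocomma p' q' j k →
                    (p : Mono W A) (q : Mono W B) →
                    IsExact p q j k →
                    IsCocomma p q j k
proposition3p11 p' q' j k cc p q ex =
  IsCocomma-restrict cc (IsExact.lax ex)
    (exact⇒lax-transfer {p' = p'} {q' = q'} (IsCocomma.lax cc) ex)
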